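{- For all positive integers $n>k$, $\mathrm{msum}(n,n-k)=\mathrm{msum}(n,k)$ and $\mathrm{disc}(n,n-k)=\mathrm{disc}(n,k)$.
   Context: $S_n$ denotes the set of permutations $\pi=(\pi_1,\ldots,\pi_n)$ of $1,\ldots,n$, with indices taken cyclically: $\pi_{n+i}=\pi_i$. For $\pi\in S_n$ and $1\le k<n$ let $s_i=\sum_{j=0}^{k-1}\pi_{i+j}$ for $i=1,\ldots,n$. Define $\mathrm{msum}(\pi,k)=\max\{s_i: 1\le i\le n\}-\frac{k(n+1)}{2}$, $\mathrm{msum}(n,k)=\min\{\mathrm{msum}(\pi,k):\pi\in S_n\}$, $\mathrm{disc}(\pi,k)=\max\{|s_i-\frac{k(n+1)}{2}|: 1\le i\le n\}$ and $\mathrm{disc}(n,k)=\min\{\mathrm{disc}(\pi,k):\pi\in S_n\}$. -}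

module Defs where

open import Data.Nat as ℕ using (ℕ; zero; suc; NonZero)
open import Data.Nat.DivMod using (_mod_)
open import Data.Fin using (Fin; toℕ)
open import Data.Fin.Permutation using (Permutation′; _⟨$⟩ʳ_)
open import Data.List using (List; []; _∷_; foldr; map; allFin)
open import Data.Integer using (+_)
open import Data.Rational using (ℚ; _/_; _-_; _⊔_; ∣_∣; 0ℚ; _≤_)
open import Data.Product using (Σ; _×_; _,_)
open import Relation.Binary.PropositionalEquality using (_≡_)

-- A permutation π = (π_1,…,π_n) of 1,…,n is represented by a bijection
-- σ : Fin n ↔ Fin n, with π_{i+1} = 1 + toℕ (σ i) for i = 0,…,n-1.
-- Positions are 0-based and taken cyclically (mod n).
val : {n : ℕ} .{{_ : NonZero n}} → Permutation′ n → ℕ → ℕ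
val {n} σ m = suc (toℕ (σ ⟨$⟩ʳ (m mod n)))

windowSum : {n : ℕ} .{{_ : NonZero n}} → Permutation′ n → ℕ → ℕ → ℕ
windowSum σ k i = go k
  where
  go : ℕ → ℕ
  go zero    = 0
  go (suc j) = go j ℕ.+ val σ (i ℕ.+ j)

-- maximum of a list of rationals (all lists used below are nonempty and
-- consist of nonnegative values, so starting the fold at 0 is harmless
-- for disc; for msum we take the maximum in ℕ first)
maxℕ : List ℕ → ℕ
maxℕ = foldr ℕ._⊔_ 0

maxℚ : List ℚ → ℚ
maxℚ = foldr _⊔_ 0ℚ

centre : ℕ → ℕ → ℚ
centre n k = + (k ℕ.* (n ℕ.+ 1)) / 2

msumπ : {n : ℕ} .{{_ : NonZero n}} → Permutation′ n → ℕ → ℚ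
msumπ {n} σ k =
  (+ maxℕ (map (λ (i : Fin n) → windowSum σ k (toℕ i)) (allFin n)) / 1) - centre n k

discπ : {n : ℕ} .{{_ : NonZero n}} → Permutation′ n → ℕ → ℚ
discπ {n} σ k =
  maxℚ (map (λ (i : Fin n) → ∣ (+ windowSum σ k (toℕ i) / 1) - centre n k ∣) (allFin n))

IsMinOverSₙ : (n : ℕ) → (Permutation′ n → ℚ) → ℚ → Set
IsMinOverSₙ n f m = Σ (Permutation′ n) (λ σ → f σ ≡ m) × ((σ : Permutation′ n) → m ≤ f σ)

IsMsum : (n : ℕ) .{{_ : NonZero n}} → ℕ → ℚ → Set
IsMsum n k m = IsMinOverSₙ n (λ σ → msumπ σ k) m

IsDisc : (n : ℕ) .{{_ : NonZero n}} → ℕ → ℚ → Set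
IsDisc n k m = IsMinOverSₙ n (λ σ → discπ σ k) m

module Submission where

-- Write k′ = n − k, so k + k′ = n, and let S = n(n+1)/2 be
-- the sum of any full window.  For a permutation π define its dual
--     π*_m = n + 1 − π_{m+k}          (complement, then rotate by k).
-- The window of π* of length k′ starting at i is complementary to the
-- window of π of length k′ starting at i + k, and the latter together with
-- the k-window of π at i fills a full window.  Hence
--     s*_i − k′(n+1)/2 = s_i − k(n+1)/2        for every start i,
-- so msum(π*, k′) = msum(π, k) and disc(π*, k′) = disc(π, k).  Dualising
-- with k′ in place of k maps back, so both functions on S_n take the same
-- values and therefore have the same minimum.

open import Defs
open import Data.Nat using (ℕ; NonZero; _≤_; _<_; _∸_)
open import Data.Rational using (ℚ)
open import Data.Product using (Σ; _×_; _,_)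

open import Data.Nat using (zero; suc; _+_; _*_; _%_; _⊔_)
open import Data.Nat.Properties
  using ( +-identityʳ; +-comm; +-assoc; +-suc; +-cancelˡ-≡; +-cancelʳ-≡
        ; *-distribʳ-+; *-distribˡ-+; +-distribˡ-⊔; +-distribʳ-⊔; ⊔-identityʳ
        ; m∸n+n≡m; m+[n∸m]≡n; <⇒≤; +-0-commutativeMonoid )
open import Data.Nat.DivMod using (_mod_; m%n<n; m%n%n≡m%n; %-distribˡ-+; [m+n]%n≡m%n; m<n⇒m%n≡m)
import Data.Nat.Tactic.RingSolver as ℕ-Solver
open import Algebra.Properties.CommutativeMonoid.Sum +-0-commutativeMonoid using (sum; sum-permute; sum-cong-≗)
import Data.Integer as ℤ
import Data.Integer.Properties as ℤₚ
import Data.Integer.Tactic.RingSolver as ℤ-Solver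
import Data.Rational as ℚ
import Data.Rational.Properties as ℚₚ
open import Data.Rational.Unnormalised as ℚᵘ using (mkℚᵘ; *≡*)
import Data.Rational.Unnormalised.Properties as ℚᵘₚ
open import Data.Fin using (Fin; toℕ; opposite; punchIn) renaming (zero to fzero; suc to fsuc)
open import Data.Fin.Properties using (toℕ-injective; toℕ-fromℕ<; toℕ<n; opposite-prop)
open import Data.Fin.Permutation
  using (Permutation′; _⟨$⟩ʳ_; _≈_; _∘ₚ_; id; permutation; reverse; insert; remove; insert-punchIn; insert-remove)
open import Data.List using (List; []; _∷_; map; concatMap; allFin; tabulate)
open import Data.List.Properties using (map-cong)
open import Data.List.Relation.Unary.Any using (Any; here)
import Data.List.Relation.Unary.Any as Any
import Data.List.Relation.Unary.Any.Properties as Anyₚ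
open import Data.List.Relation.Unary.All using (lookupWith)
open import Data.List.Membership.Propositional.Properties using (∈-allFin)
open import Relation.Binary using (DecTotalOrder)
open import Data.List.Extrema (DecTotalOrder.totalOrder ℚₚ.≤-decTotalOrder) using (argmin; f[argmin]≤f[xs])
open import Relation.Binary.PropositionalEquality using (_≡_; refl; sym; trans; cong; cong₂; subst; module ≡-Reasoning)

insert-≈ : ∀ {n} (σ : Permutation′ (suc n)) {τ : Permutation′ n} →
           τ ≈ remove fzero σ → insert fzero (σ ⟨$⟩ʳ fzero) τ ≈ σ
insert-≈ σ τ≈ fzero = insert-remove fzero σ fzero
insert-≈ σ {τ} τ≈ (fsuc i) = begin
    insert fzero j τ ⟨$⟩ʳ fsuc i                  ≡⟨ insert-punchIn fzero j τ i ⟩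
    punchIn j (τ ⟨$⟩ʳ i)                          ≡⟨ cong (punchIn j) (τ≈ i) ⟩
    punchIn j (remove fzero σ ⟨$⟩ʳ i)             ≡⟨ sym (insert-punchIn fzero j (remove fzero σ) i) ⟩
    insert fzero j (remove fzero σ) ⟨$⟩ʳ fsuc i   ≡⟨ insert-remove fzero σ (fsuc i) ⟩
    σ ⟨$⟩ʳ fsuc i                                 ∎
  where
  open ≡-Reasoning
  j = σ ⟨$⟩ʳ fzero

permutations : ∀ n → List (Permutation′ n)
permutations zero    = id ∷ []
permutations (suc n) = concatMap (λ j → map (insert fzero j) (permutations n)) (allFin (suc n))

-- Every permutation occurs in the list, up to pointwise equality (which is
-- all one can ask for without function extensionality).
permutations-complete : ∀ n (σ : Permutation′ n) → Any (_≈ σ) (permutations n)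
permutations-complete zero    σ = here (λ ())
permutations-complete (suc n) σ =
  Anyₚ.concat⁺ (Anyₚ.map⁺ (Any.map (λ { refl → inserted }) (∈-allFin (σ ⟨$⟩ʳ fzero))))
  where
  inserted : Any (_≈ σ) (map (insert fzero (σ ⟨$⟩ʳ fzero)) (permutations n))
  inserted = Anyₚ.map⁺ (Any.map (insert-≈ σ) (permutations-complete n (remove fzero σ)))

minimum-exists : ∀ n (f : Permutation′ n → ℚ) → (∀ {σ τ} → σ ≈ τ → f σ ≡ f τ) →
                 Σ ℚ (IsMinOverSₙ n f)
minimum-exists n f f-resp = f σ₀ , (σ₀ , refl) , below
  where
  σ₀ = argmin f id (permutations n)
  below : ∀ σ → f σ₀ ℚ.≤ f σ
  below σ = lookupWith (λ σ₀≤τ τ≈σ → subst (f σ₀ ℚ.≤_) (f-resp τ≈σ) σ₀≤τ)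
                       (f[argmin]≤f[xs] id (permutations n)) (permutations-complete n σ)

shared-minimum : ∀ {n} (f g : Permutation′ n → ℚ) (F G : Permutation′ n → Permutation′ n) →
                 (∀ {σ τ} → σ ≈ τ → g σ ≡ g τ) →
                 (∀ σ → f (F σ) ≡ g σ) → (∀ σ → g (G σ) ≡ f σ) →
                 Σ ℚ (λ m → IsMinOverSₙ n f m × IsMinOverSₙ n g m)
shared-minimum {n} f g F G g-resp fF≡g gG≡f with minimum-exists n g g-resp
... | m , g-min@((σ , gσ≡m) , m≤g) =
  m , ((F σ , trans (fF≡g σ) gσ≡m) , λ τ → subst (m ℚ.≤_) (gG≡f τ) (m≤g (G τ))) , g-min

module _ {n : ℕ} .{{_ : NonZero n}} where

  toℕ-mod : ∀ a → toℕ (a mod n) ≡ a % n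
  toℕ-mod a = toℕ-fromℕ< (m%n<n a n)

  mod-cong : ∀ {a b} → a % n ≡ b % n → a mod n ≡ b mod n
  mod-cong {a} {b} a≡b = toℕ-injective (trans (toℕ-mod a) (trans a≡b (sym (toℕ-mod b))))

  mod-shift : ∀ a j → (toℕ (a mod n) + j) mod n ≡ (a + j) mod n
  mod-shift a j = mod-cong (begin
      (toℕ (a mod n) + j) % n        ≡⟨ cong (λ r → (r + j) % n) (toℕ-mod a) ⟩
      (a % n + j) % n                ≡⟨ %-distribˡ-+ (a % n) j n ⟩
      (a % n % n + j % n) % n        ≡⟨ cong (λ r → (r + j % n) % n) (m%n%n≡m%n a n) ⟩
      (a % n + j % n) % n            ≡⟨ sym (%-distribˡ-+ a j n) ⟩
      (a + j) % n                    ∎)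
    where open ≡-Reasoning

  toℕ-mod-id : (t : Fin n) → toℕ t mod n ≡ t
  toℕ-mod-id t = toℕ-injective (trans (toℕ-mod (toℕ t)) (m<n⇒m%n≡m (toℕ<n t)))

  module _ (σ : Permutation′ n) where

    val-periodic : ∀ m → val σ (m + n) ≡ val σ m
    val-periodic m = cong (λ r → suc (toℕ (σ ⟨$⟩ʳ r))) (mod-cong ([m+n]%n≡m%n m n))

    windowSum-split : ∀ a b i → windowSum σ (a + b) i ≡ windowSum σ a i + windowSum σ b (i + a)
    windowSum-split a zero i = trans (cong (λ l → windowSum σ l i) (+-identityʳ a))
                                     (sym (+-identityʳ (windowSum σ a i)))
    windowSum-split a (suc b) i = begin
        windowSum σ (a + suc b) i                              ≡⟨ cong (λ l → windowSum σ l i) (+-suc a b) ⟩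
        windowSum σ (a + b) i + val σ (i + (a + b))            ≡⟨ cong₂ _+_ (windowSum-split a b i)
                                                                           (cong (val σ) (sym (+-assoc i a b))) ⟩
        windowSum σ a i + windowSum σ b (i + a) + val σ (i + a + b)
                                                               ≡⟨ +-assoc (windowSum σ a i) _ _ ⟩
        windowSum σ a i + windowSum σ (suc b) (i + a)          ∎
      where open ≡-Reasoning

    windowSum-cons : ∀ k i → windowSum σ (suc k) i ≡ val σ i + windowSum σ k (suc i)
    windowSum-cons k i = trans (windowSum-split 1 k i)
      (cong₂ _+_ (cong (val σ) (+-identityʳ i)) (cong (windowSum σ k) (+-comm i 1)))

    -- All full windows have the same sum (the entries are just rotated).
    windowSum-full : ∀ i → windowSum σ n i ≡ windowSum σ n 0
    windowSum-full zero    = refl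
    windowSum-full (suc i) = trans (+-cancelˡ-≡ (val σ i) _ _ shifted) (windowSum-full i)
      where
      shifted : val σ i + windowSum σ n (suc i) ≡ val σ i + windowSum σ n i
      shifted = begin
          val σ i + windowSum σ n (suc i)   ≡⟨ sym (windowSum-cons n i) ⟩
          windowSum σ n i + val σ (i + n)   ≡⟨ cong (windowSum σ n i +_) (val-periodic i) ⟩
          windowSum σ n i + val σ i         ≡⟨ +-comm (windowSum σ n i) (val σ i) ⟩
          val σ i + windowSum σ n i         ∎
        where open ≡-Reasoning

    windowSum-as-sum : ∀ k i → windowSum σ k i ≡ sum {k} (λ t → val σ (i + toℕ t))
    windowSum-as-sum zero    i = refl
    windowSum-as-sum (suc k) i = begin
        windowSum σ (suc k) i                                ≡⟨ windowSum-cons k i ⟩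
        val σ i + windowSum σ k (suc i)                      ≡⟨ cong₂ _+_ (cong (val σ) (sym (+-identityʳ i)))
                                                                          (windowSum-as-sum k (suc i)) ⟩
        val σ (i + 0) + sum {k} (λ t → val σ (suc i + toℕ t)) ≡⟨ cong (val σ (i + 0) +_)
                                                                  (sum-cong-≗ {k} (λ t → cong (val σ) (sym (+-suc i (toℕ t))))) ⟩
        val σ (i + 0) + sum {k} (λ t → val σ (i + suc (toℕ t))) ∎
      where open ≡-Reasoning

    windowSum-total : windowSum σ n 0 ≡ sum {n} (λ t → suc (toℕ t))
    windowSum-total = begin
        windowSum σ n 0                           ≡⟨ windowSum-as-sum n 0 ⟩
        sum {n} (λ t → val σ (toℕ t))             ≡⟨ sum-cong-≗ {n} (λ t → cong (λ r → suc (toℕ (σ ⟨$⟩ʳ r))) (toℕ-mod-id t)) ⟩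
        sum {n} (λ t → suc (toℕ (σ ⟨$⟩ʳ t)))      ≡⟨ sym (sum-permute (λ t → suc (toℕ t)) σ) ⟩
        sum {n} (λ t → suc (toℕ t))               ∎
      where open ≡-Reasoning

windowSum-resp : ∀ {n} .{{_ : NonZero n}} {σ τ : Permutation′ n} → σ ≈ τ →
                 ∀ k i → windowSum σ k i ≡ windowSum τ k i
windowSum-resp σ≈τ zero    i = refl
windowSum-resp σ≈τ (suc k) i = cong₂ _+_ (windowSum-resp σ≈τ k i) (cong (λ r → suc (toℕ r)) (σ≈τ _))

opposite-complement : ∀ {n} (t : Fin n) → suc (toℕ (opposite t)) + suc (toℕ t) ≡ n + 1
opposite-complement {n} t = begin
    suc (toℕ (opposite t)) + suc (toℕ t)   ≡⟨ cong (λ r → suc r + suc (toℕ t)) (opposite-prop t) ⟩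
    suc (n ∸ suc (toℕ t) + suc (toℕ t))    ≡⟨ cong suc (m∸n+n≡m (toℕ<n t)) ⟩
    suc n                                  ≡⟨ +-comm 1 n ⟩
    n + 1                                  ∎
  where open ≡-Reasoning

module _ {n : ℕ} .{{_ : NonZero n}} where

  shift : ℕ → Fin n → Fin n
  shift j i = (toℕ i + j) mod n

  shift-inverse : ∀ {j j′} → j + j′ ≡ n → ∀ i → shift j′ (shift j i) ≡ i
  shift-inverse {j} {j′} e i = begin
      (toℕ ((toℕ i + j) mod n) + j′) mod n   ≡⟨ mod-shift (toℕ i + j) j′ ⟩
      (toℕ i + j + j′) mod n                 ≡⟨ cong (_mod n) (trans (+-assoc (toℕ i) j j′) (cong (toℕ i +_) e)) ⟩
      (toℕ i + n) mod n                      ≡⟨ mod-cong ([m+n]%n≡m%n (toℕ i) n) ⟩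
      toℕ i mod n                            ≡⟨ toℕ-mod-id i ⟩
      i                                      ∎
    where open ≡-Reasoning

  rotate : ∀ j j′ → j + j′ ≡ n → Permutation′ n
  rotate j j′ e = permutation (shift j) (shift j′)
    (shift-inverse (trans (+-comm j′ j) e)) (shift-inverse e)

  -- The dual of π with respect to j:  π*_m = n + 1 − π_{m+j}.
  dual : ∀ j j′ → j + j′ ≡ n → Permutation′ n → Permutation′ n
  dual j j′ e σ = rotate j j′ e ∘ₚ (σ ∘ₚ reverse)

  module _ (j j′ : ℕ) (e : j + j′ ≡ n) (σ : Permutation′ n) where

    private
      σ* = dual j j′ e σ

    val-dual : ∀ m → val σ* m + val σ (m + j) ≡ n + 1
    val-dual m = begin
        suc (toℕ (opposite (σ ⟨$⟩ʳ shift j (m mod n)))) + val σ (m + j)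
          ≡⟨ cong (λ r → suc (toℕ (opposite (σ ⟨$⟩ʳ r))) + val σ (m + j)) (mod-shift m j) ⟩
        suc (toℕ (opposite (σ ⟨$⟩ʳ ((m + j) mod n)))) + val σ (m + j)
          ≡⟨ opposite-complement (σ ⟨$⟩ʳ ((m + j) mod n)) ⟩
        n + 1 ∎
      where open ≡-Reasoning

    windowSum-dual : ∀ l i → windowSum σ* l i + windowSum σ l (i + j) ≡ l * (n + 1)
    windowSum-dual zero    i = refl
    windowSum-dual (suc l) i = begin
        (a + b) + (c + val σ (i + j + l))   ≡⟨ cong (λ p → (a + b) + (c + val σ p)) (+-shuffle i j l) ⟩
        (a + b) + (c + d)                   ≡⟨ interchange a b c d ⟩
        (a + c) + (b + d)                   ≡⟨ cong₂ _+_ (windowSum-dual l i) (val-dual (i + l)) ⟩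
        l * (n + 1) + (n + 1)               ≡⟨ +-comm (l * (n + 1)) (n + 1) ⟩
        suc l * (n + 1)                     ∎
      where
      open ≡-Reasoning
      a = windowSum σ* l i
      b = val σ* (i + l)
      c = windowSum σ l (i + j)
      d = val σ (i + l + j)
      +-shuffle : ∀ x y z → x + y + z ≡ x + z + y
      +-shuffle = ℕ-Solver.solve-∀
      interchange : ∀ w x y z → (w + x) + (y + z) ≡ (w + y) + (x + z)
      interchange = ℕ-Solver.solve-∀

    -- The key identity: the (n − j)-window of σ* at i and the j-window of σ
    -- at i differ by a constant, since σ's j-window at i and its (n − j)-window
    -- at i + j make up a full window.
    windowSum-duality : ∀ i → windowSum σ* j′ i + windowSum σ n 0 ≡ j′ * (n + 1) + windowSum σ j i
    windowSum-duality i = begin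
        P + windowSum σ n 0           ≡⟨ cong (P +_) (sym (windowSum-full σ i)) ⟩
        P + windowSum σ n i           ≡⟨ cong (λ l → P + windowSum σ l i) (sym e) ⟩
        P + windowSum σ (j + j′) i    ≡⟨ cong (P +_) (windowSum-split σ j j′ i) ⟩
        P + (Q + R)                   ≡⟨ swap P Q R ⟩
        (P + R) + Q                   ≡⟨ cong (_+ Q) (windowSum-dual j′ i) ⟩
        j′ * (n + 1) + Q              ∎
      where
      open ≡-Reasoning
      P = windowSum σ* j′ i
      Q = windowSum σ j i
      R = windowSum σ j′ (i + j)
      swap : ∀ x y z → x + (y + z) ≡ (x + z) + y
      swap = ℕ-Solver.solve-∀

  -- Twice the full-window sum is n(n + 1): pair σ with its dual for j = 0,
  -- whose full window holds the same values.
  windowSum-total-twice : (σ : Permutation′ n) → 2 * windowSum σ n 0 ≡ n * (n + 1)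
  windowSum-total-twice σ = begin
      2 * S                         ≡⟨ cong (S +_) (+-identityʳ S) ⟩
      S + S                         ≡⟨ cong (_+ S) (trans (windowSum-total σ) (sym (windowSum-total σ*))) ⟩
      windowSum σ* n 0 + S          ≡⟨ windowSum-dual 0 n refl σ n 0 ⟩
      n * (n + 1)                   ∎
    where
    open ≡-Reasoning
    S = windowSum σ n 0
    σ* = dual 0 n refl σ

  windowSum-total-split : ∀ j j′ → j + j′ ≡ n → (σ : Permutation′ n) →
                          2 * windowSum σ n 0 ≡ j * (n + 1) + j′ * (n + 1)
  windowSum-total-split j j′ e σ = begin
      2 * windowSum σ n 0       ≡⟨ windowSum-total-twice σ ⟩
      n * (n + 1)               ≡⟨ cong (_* (n + 1)) (sym e) ⟩
      (j + j′) * (n + 1)        ≡⟨ *-distribʳ-+ (n + 1) j j′ ⟩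
      j * (n + 1) + j′ * (n + 1) ∎
    where open ≡-Reasoning

maxℕ-shift : {A : Set} (f g : A → ℕ) {c d : ℕ} → (∀ y → f y + c ≡ d + g y) →
             ∀ x xs → maxℕ (map f (x ∷ xs)) + c ≡ d + maxℕ (map g (x ∷ xs))
maxℕ-shift f g {c} {d} shifted x [] = begin
    (f x ⊔ 0) + c   ≡⟨ cong (_+ c) (⊔-identityʳ (f x)) ⟩
    f x + c         ≡⟨ shifted x ⟩
    d + g x         ≡⟨ cong (d +_) (sym (⊔-identityʳ (g x))) ⟩
    d + (g x ⊔ 0)   ∎
  where open ≡-Reasoning
maxℕ-shift f g {c} {d} shifted x (x′ ∷ xs) = begin
    (f x ⊔ M) + c            ≡⟨ +-distribʳ-⊔ c (f x) M ⟩
    (f x + c) ⊔ (M + c)      ≡⟨ cong₂ _⊔_ (shifted x) (maxℕ-shift f g shifted x′ xs) ⟩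
    (d + g x) ⊔ (d + M′)     ≡⟨ sym (+-distribˡ-⊔ d (g x) M′) ⟩
    d + (g x ⊔ M′)           ∎
  where
  open ≡-Reasoning
  M  = maxℕ (map f (x′ ∷ xs))
  M′ = maxℕ (map g (x′ ∷ xs))

deviation : ℕ → ℕ → ℚ
deviation x K = (ℤ.+ x ℚ./ 1) ℚ.- (ℤ.+ K ℚ./ 2)

toℚᵘ-deviation : ∀ x K → ℚ.toℚᵘ (deviation x K) ℚᵘ.≃ (mkℚᵘ (ℤ.+ x) 0 ℚᵘ.- mkℚᵘ (ℤ.+ K) 1)
toℚᵘ-deviation x K = ℚᵘₚ.≃-trans (ℚₚ.toℚᵘ-homo-+ (ℤ.+ x ℚ./ 1) (ℚ.- (ℤ.+ K ℚ./ 2)))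
  (ℚᵘₚ.+-cong (ℚₚ.toℚᵘ-fromℚᵘ (mkℚᵘ (ℤ.+ x) 0))
              (ℚᵘₚ.≃-trans (ℚₚ.toℚᵘ-homo‿- (ℤ.+ K ℚ./ 2)) (ℚᵘₚ.-‿cong (ℚₚ.toℚᵘ-fromℚᵘ (mkℚᵘ (ℤ.+ K) 1)))))

deviation-cong : ∀ x y K K′ → 2 * x + K ≡ 2 * y + K′ → deviation x K′ ≡ deviation y K
deviation-cong x y K K′ eq = ℚₚ.toℚᵘ-injective
  (ℚᵘₚ.≃-trans (toℚᵘ-deviation x K′)
  (ℚᵘₚ.≃-trans (*≡* (cong (ℤ._* ℤ.+ 2) numerators)) (ℚᵘₚ.≃-sym (toℚᵘ-deviation y K))))
  where
  open ≡-Reasoning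
  embed : ∀ a b → ℤ.+ (2 * a + b) ≡ ℤ.+ 2 ℤ.* ℤ.+ a ℤ.+ ℤ.+ b
  embed a b = trans (ℤₚ.pos-+ (2 * a) b) (cong (ℤ._+ ℤ.+ b) (ℤₚ.pos-* 2 a))
  regroup : ∀ A P Q → A ℤ.* ℤ.+ 2 ℤ.+ ℤ.- Q ℤ.* ℤ.+ 1 ≡ (ℤ.+ 2 ℤ.* A ℤ.+ P) ℤ.- (P ℤ.+ Q)
  regroup = ℤ-Solver.solve-∀
  numerators : ℤ.+ x ℤ.* ℤ.+ 2 ℤ.+ ℤ.- ℤ.+ K′ ℤ.* ℤ.+ 1 ≡ ℤ.+ y ℤ.* ℤ.+ 2 ℤ.+ ℤ.- ℤ.+ K ℤ.* ℤ.+ 1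
  numerators = begin
    ℤ.+ x ℤ.* ℤ.+ 2 ℤ.+ ℤ.- ℤ.+ K′ ℤ.* ℤ.+ 1   ≡⟨ regroup (ℤ.+ x) (ℤ.+ K) (ℤ.+ K′) ⟩
    (ℤ.+ 2 ℤ.* ℤ.+ x ℤ.+ ℤ.+ K) ℤ.- (ℤ.+ K ℤ.+ ℤ.+ K′)
      ≡⟨ cong (ℤ._- (ℤ.+ K ℤ.+ ℤ.+ K′)) (trans (sym (embed x K)) (trans (cong ℤ.+_ eq) (embed y K′))) ⟩
    (ℤ.+ 2 ℤ.* ℤ.+ y ℤ.+ ℤ.+ K′) ℤ.- (ℤ.+ K ℤ.+ ℤ.+ K′)
      ≡⟨ cong (λ z → (ℤ.+ 2 ℤ.* ℤ.+ y ℤ.+ ℤ.+ K′) ℤ.- z) (ℤₚ.+-comm (ℤ.+ K) (ℤ.+ K′)) ⟩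
    (ℤ.+ 2 ℤ.* ℤ.+ y ℤ.+ ℤ.+ K′) ℤ.- (ℤ.+ K′ ℤ.+ ℤ.+ K)
      ≡⟨ sym (regroup (ℤ.+ y) (ℤ.+ K′) (ℤ.+ K)) ⟩
    ℤ.+ y ℤ.* ℤ.+ 2 ℤ.+ ℤ.- ℤ.+ K ℤ.* ℤ.+ 1   ∎

deviation-balance : ∀ x y S K K′ → x + S ≡ K′ + y → 2 * S ≡ K + K′ → deviation x K′ ≡ deviation y K
deviation-balance x y S K K′ shifted total =
  deviation-cong x y K K′ (+-cancelʳ-≡ K′ _ _ (begin
    2 * x + K + K′     ≡⟨ +-assoc (2 * x) K K′ ⟩
    2 * x + (K + K′)   ≡⟨ cong (2 * x +_) (sym total) ⟩
    2 * x + 2 * S      ≡⟨ sym (*-distribˡ-+ 2 x S) ⟩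
    2 * (x + S)        ≡⟨ cong (2 *_) shifted ⟩
    2 * (K′ + y)       ≡⟨ expand K′ y ⟩
    2 * y + K′ + K′    ∎))
  where
  open ≡-Reasoning
  expand : ∀ a b → 2 * (a + b) ≡ 2 * b + a + a
  expand = ℕ-Solver.solve-∀

msumπ-resp : ∀ {n} .{{_ : NonZero n}} k {σ τ : Permutation′ n} → σ ≈ τ → msumπ σ k ≡ msumπ τ k
msumπ-resp {n} k σ≈τ = cong (λ M → deviation M (k * (n + 1)))
  (cong maxℕ (map-cong (λ i → windowSum-resp σ≈τ k (toℕ i)) (allFin n)))

discπ-resp : ∀ {n} .{{_ : NonZero n}} k {σ τ : Permutation′ n} → σ ≈ τ → discπ σ k ≡ discπ τ k
discπ-resp {n} k σ≈τ = cong maxℚ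
  (map-cong (λ i → cong (λ s → ℚ.∣ deviation s (k * (n + 1)) ∣) (windowSum-resp σ≈τ k (toℕ i))) (allFin n))

msum-dual : ∀ {n′} j j′ (e : j + j′ ≡ suc n′) (σ : Permutation′ (suc n′)) →
            msumπ (dual j j′ e σ) j′ ≡ msumπ σ j
msum-dual {n′} j j′ e σ =
  deviation-balance (maxWindow σ* j′) (maxWindow σ j) (windowSum σ n 0) (j * (n + 1)) (j′ * (n + 1))
    (maxℕ-shift (window σ* j′) (window σ j) (λ i → windowSum-duality j j′ e σ (toℕ i)) fzero (tabulate fsuc))
    (windowSum-total-split j j′ e σ)
  where
  n = suc n′
  σ* = dual j j′ e σ
  window : Permutation′ n → ℕ → Fin n → ℕ
  window τ l i = windowSum τ l (toℕ i)
  maxWindow : Permutation′ n → ℕ → ℕ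
  maxWindow τ l = maxℕ (map (window τ l) (allFin n))

-- Duality for disc: the deviations already agree window by window.
disc-dual : ∀ {n} .{{_ : NonZero n}} j j′ (e : j + j′ ≡ n) (σ : Permutation′ n) →
            discπ (dual j j′ e σ) j′ ≡ discπ σ j
disc-dual {n} j j′ e σ = cong maxℚ (map-cong (λ i → cong ℚ.∣_∣ (windowwise (toℕ i))) (allFin n))
  where
  σ* = dual j j′ e σ
  windowwise : ∀ i → deviation (windowSum σ* j′ i) (j′ * (n + 1)) ≡ deviation (windowSum σ j i) (j * (n + 1))
  windowwise i = deviation-balance (windowSum σ* j′ i) (windowSum σ j i) (windowSum σ n 0) (j * (n + 1)) (j′ * (n + 1))
    (windowSum-duality j j′ e σ i) (windowSum-total-split j j′ e σ)

-- The theorem: dualising with (k, n − k) and with (n − k, k) translates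
-- msum(·, n − k) and msum(·, k) into each other, and likewise disc.
proposition2p1 : (n k : ℕ) .{{_ : NonZero n}} → 1 ≤ k → k < n →
    (Σ ℚ (λ m → IsMsum n (n ∸ k) m × IsMsum n k m))
    × (Σ ℚ (λ m → IsDisc n (n ∸ k) m × IsDisc n k m))
proposition2p1 (suc n′) k _ k<n =
    shared-minimum (λ σ → msumπ σ k′) (λ σ → msumπ σ k) (dual k k′ e) (dual k′ k e′)
                   (msumπ-resp k) (msum-dual k k′ e) (msum-dual k′ k e′)
  , shared-minimum (λ σ → discπ σ k′) (λ σ → discπ σ k) (dual k k′ e) (dual k′ k e′)
                   (discπ-resp k) (disc-dual k k′ e) (disc-dual k′ k e′)
  where
  n = suc n′
  k′ = n ∸ k
  e : k + k′ ≡ n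
  e = m+[n∸m]≡n (<⇒≤ k<n)
  e′ : k′ + k ≡ n
  e′ = m∸n+n≡m (<⇒≤ k<n)
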